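{- For every integer $N\ge1$, \[ \tilde S(N)-S(N)\le N\tau(N)\qquad\text{and}\qquad S(N)-\bar S(N)\le N\tau(N). \]
   Context: For $E\subset\mathbb R$, $q(E)=\min\{q\in\mathbb N^*:\exists p\in\mathbb Z,\ p/q\in E\}$ ($=\infty$ if $E\cap\mathbb Q=\emptyset$). For $N\in\mathbb N^*$: $S(N)=\sum_{j=1}^N q\big(](j-1)/N,j/N]\big)$, $\bar S(N)=\sum_{j=1}^N q\big([(j-1)/N,j/N]\big)$, $\tilde S(N)=\sum_{j=1}^N q\big(](j-1)/N,j/N[\big)$. $\tau(N)$ is the number of divisors of $N$. -}

module Defs where

open import Data.Nat using (ℕ; zero; suc; _+_; _*_; _<_; NonZero)
open import Data.Nat.Divisibility using (_∣?_)
open import Data.Integer using (ℤ; +_)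
open import Data.Rational using (ℚ; _/_) renaming (_<_ to _<ℚ_; _≤_ to _≤ℚ_)
open import Data.Fin using (Fin; toℕ)
open import Data.List using (List; length; filter; map; upTo; allFin)
open import Data.Nat.ListAction using (sum)
open import Data.Product using (Σ; _×_)
open import Relation.Binary.PropositionalEquality using (_≡_)
open import Relation.Nullary using (¬_)

Subset : Set₁
Subset = ℚ → Set

Ioc Icc Ioo : ℚ → ℚ → Subset
Ioc a b x = (a <ℚ x) × (x ≤ℚ b)
Icc a b x = (a ≤ℚ x) × (x ≤ℚ b)
Ioo a b x = (a <ℚ x) × (x <ℚ b)

HasDen : Subset → ℕ → Set
HasDen E k = Σ ℤ (λ p → E (p / suc k))

-- IsQ E q :  q = q(E) = min { q ≥ 1 : ∃ p ∈ ℤ, p/q ∈ E }  (q(E) finite)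
IsQ : Subset → ℕ → Set
IsQ E q = Σ ℕ (λ k → (q ≡ suc k) × HasDen E k × (∀ k' → k' < k → ¬ HasDen E k'))

-- endpoints (j-1)/N and j/N, where j-1 = toℕ i for i : Fin N
lo hi : (N : ℕ) → .{{_ : NonZero N}} → Fin N → ℚ
lo N i = (+ toℕ i) / N
hi N i = (+ suc (toℕ i)) / N

sumFin : (N : ℕ) → (Fin N → ℕ) → ℕ
sumFin N f = sum (map f (allFin N))

τ : ℕ → ℕ
τ N = length (filter (_∣? N) (map suc (upTo N)))

-- Adding or removing an endpoint e of a cell can only change q when e is itself the fraction
-- of least denominator in the larger cell.  Write e = a/d in lowest terms, so d = N/g with
-- g = gcd(N e, N); then d ≤ q(larger cell).  As a is invertible mod d, every window of d
-- consecutive integers contains an s with a s ≡ ±1 (mod d), i.e. a Farey neighbour r/s of e,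
-- and |e - r/s| = g/(N s) < 1/N once s > g, so r/s lies in the smaller cell.  Choosing
-- s ∈ ]g, g + d] gives q(smaller) ≤ q(larger) + g, and summing over the cells,
-- Σ_j gcd(j, N) ≤ Σ_{e ∣ N} e · N/e = N τ(N).
module Submission where

open import Defs
open import Data.Nat using (ℕ; zero; suc; pred; _+_; _*_; _≤_; _<_; z≤n; s≤s; z<s; _<?_; NonZero; ≢-nonZero; ≢-nonZero⁻¹; >-nonZero⁻¹)
open import Data.Nat.Properties
open import Algebra.Properties.CommutativeSemigroup +-commutativeSemigroup using () renaming (interchange to +-interchange)
open import Data.Nat.DivMod using (_%_; _/_; m≡m%n+[m/n]*n; m%n<n; m/n*n≡m)
open import Data.Nat.Divisibility
  using (_∣_; _∣?_; divides; divides-refl; 0∣⇒≡0; ∣⇒≤; ∣m+n∣m⇒∣n; ∣m∣n⇒∣m+n; n∣m*n; ∣m⇒∣m*n)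
open import Data.Nat.GCD using (gcd; gcd[m,n]≢0; gcd[m,n]∣m; gcd[m,n]∣n; module Bézout)
open import Data.Nat.Coprimality using (Coprime; coprime-/gcd; coprime-divisor; coprime-Bézout)
import Data.Nat.Coprimality as Coprime
open import Data.Nat.Tactic.RingSolver using (solve-∀)
open import Data.Nat.ListAction using (sum)
open import Data.Nat.ListAction.Properties using (sum-++)
import Data.Integer as ℤ
import Data.Integer.Properties as ℤ
open import Data.Rational using (ℚ; toℚᵘ; mkℚ) renaming (_/_ to _÷_; _<_ to _<ℚ_; _≤_ to _≤ℚ_)
open import Data.Rational.Properties using (toℚᵘ-mono-<; toℚᵘ-cancel-<; toℚᵘ-mono-≤; toℚᵘ-cancel-≤; ↥p/↧p≡p; /-injective-≃)
open import Data.Rational.Unnormalised as ℚᵘ using (mkℚᵘ; *<*; *≤*) renaming (_≃_ to _≃ᵘ_)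
import Data.Rational.Unnormalised.Properties as ℚᵘ
open import Data.Fin using (Fin; toℕ) renaming (suc to fsuc)
open import Data.List using (List; []; _∷_; _++_; map; filter; length; upTo; iterate; tabulate; allFin)
open import Data.List.Properties using (map-tabulate; map-∘; map-++)
open import Data.List.Membership.Propositional using (_∈_)
open import Data.List.Membership.Propositional.Properties using (∈-filter⁺; ∈-filter⁻; ∈-map⁺; ∈-upTo⁺)
open import Data.List.Relation.Unary.Any using (here; there)
open import Data.Product using (_×_; ∃-syntax; _,_; proj₂)
open import Data.Sum using (inj₂)
open import Data.Empty using (⊥-elim)
open import Function using (_∘_; case_of_; it)
open import Relation.Binary using (tri<; tri≈; tri>)
open import Relation.Binary.PropositionalEquality
open import Relation.Nullary using (yes; no; ¬_)

module _ {A : Set} where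

  sum-map-+ : ∀ (f g : A → ℕ) xs → sum (map (λ x → f x + g x) xs) ≡ sum (map f xs) + sum (map g xs)
  sum-map-+ f g [] = refl
  sum-map-+ f g (x ∷ xs) =
    trans (cong (f x + g x +_) (sum-map-+ f g xs)) (+-interchange (f x) (g x) _ _)

  sum-map-mono-≤ : ∀ {f g : A → ℕ} → (∀ x → f x ≤ g x) → ∀ xs → sum (map f xs) ≤ sum (map g xs)
  sum-map-mono-≤ f≤g [] = z≤n
  sum-map-mono-≤ f≤g (x ∷ xs) = +-mono-≤ (f≤g x) (sum-map-mono-≤ f≤g xs)

  sum-map-≤-const : ∀ (f : A → ℕ) c xs → (∀ {x} → x ∈ xs → f x ≤ c) → sum (map f xs) ≤ length xs * c
  sum-map-≤-const f c [] f≤c = z≤n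
  sum-map-≤-const f c (x ∷ xs) f≤c = +-mono-≤ (f≤c (here refl)) (sum-map-≤-const f c xs (f≤c ∘ there))

  ∈⇒≤sum-map : ∀ (f : A → ℕ) {x xs} → x ∈ xs → f x ≤ sum (map f xs)
  ∈⇒≤sum-map f (here refl) = m≤m+n _ _
  ∈⇒≤sum-map f (there x∈xs) = ≤-trans (∈⇒≤sum-map f x∈xs) (m≤n+m _ _)

module _ {A B : Set} where

  sum-map-comm : ∀ (K : A → B → ℕ) xs ys →
    sum (map (λ x → sum (map (K x) ys)) xs) ≡ sum (map (λ y → sum (map (λ x → K x y) xs)) ys)
  sum-map-comm K [] ys = sym (sum-map-zero ys)
    where
    sum-map-zero : ∀ ys → sum (map (λ (_ : B) → 0) ys) ≡ 0
    sum-map-zero [] = refl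
    sum-map-zero (_ ∷ ys) = sum-map-zero ys
  sum-map-comm K (x ∷ xs) ys = trans (cong (sum (map (K x) ys) +_) (sum-map-comm K xs ys))
                                     (sym (sum-map-+ (K x) _ ys))

iterate-suc-++ : ∀ x m n → iterate suc x (m + n) ≡ iterate suc x m ++ iterate suc (m + x) n
iterate-suc-++ x zero n = refl
iterate-suc-++ x (suc m) n =
  cong (x ∷_) (trans (iterate-suc-++ (suc x) m n) (cong (λ y → iterate suc (suc x) m ++ iterate suc y n) (+-suc m x)))

map-+-iterate : ∀ c x n → map (c +_) (iterate suc x n) ≡ iterate suc (c + x) n
map-+-iterate c x zero = refl
map-+-iterate c x (suc n) =
  cong (c + x ∷_) (trans (map-+-iterate c (suc x) n) (cong (λ y → iterate suc y n) (+-suc c x)))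

map-toℕ-allFin : ∀ n → map toℕ (allFin n) ≡ iterate suc 0 n
map-toℕ-allFin zero = refl
map-toℕ-allFin (suc n) = cong (0 ∷_) (begin
  map toℕ (tabulate fsuc)      ≡⟨ map-tabulate fsuc toℕ ⟩
  tabulate (suc ∘ toℕ)            ≡⟨ map-tabulate (λ i → i) (suc ∘ toℕ) ⟨
  map (suc ∘ toℕ) (allFin n)      ≡⟨ map-∘ (allFin n) ⟩
  map suc (map toℕ (allFin n))    ≡⟨ cong (map suc) (map-toℕ-allFin n) ⟩
  map suc (iterate suc 0 n)       ≡⟨ map-+-iterate 1 0 n ⟩
  iterate suc 1 n                 ∎)
  where open ≡-Reasoning

map-shifted-allFin : ∀ {A : Set} (F : ℕ → A) c n → map (λ i → F (c + toℕ i)) (allFin n) ≡ map F (iterate suc (c + 0) n)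
map-shifted-allFin F c n = begin
  map (λ i → F (c + toℕ i)) (allFin n)         ≡⟨ map-∘ (allFin n) ⟩
  map F (map (λ i → c + toℕ i) (allFin n))     ≡⟨ cong (map F) (map-∘ (allFin n)) ⟩
  map F (map (c +_) (map toℕ (allFin n)))      ≡⟨ cong (map F ∘ map (c +_)) (map-toℕ-allFin n) ⟩
  map F (map (c +_) (iterate suc 0 n))         ≡⟨ cong (map F) (map-+-iterate c 0 n) ⟩
  map F (iterate suc (c + 0) n)                ∎
  where open ≡-Reasoning

ifDivides : ℕ → ℕ → ℕ
ifDivides e x with e ∣? x
... | yes _ = e
... | no  _ = 0

ifDivides-yes : ∀ {e x} → e ∣ x → ifDivides e x ≡ e
ifDivides-yes {e} {x} e∣x with e ∣? x
... | yes _ = refl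
... | no ¬e∣x = ⊥-elim (¬e∣x e∣x)

ifDivides-no : ∀ {e x} → ¬ e ∣ x → ifDivides e x ≡ 0
ifDivides-no {e} {x} ¬e∣x with e ∣? x
... | yes e∣x = ⊥-elim (¬e∣x e∣x)
... | no _ = refl

sum-ifDivides-gap : ∀ {e x} k n → e ∣ x → k + n < e → sum (map (ifDivides e) (iterate suc (suc (k + x)) n)) ≡ 0
sum-ifDivides-gap k zero e∣x k+n<e = refl
sum-ifDivides-gap {e} {x} k (suc n) e∣x k+n<e =
  cong₂ _+_ (ifDivides-no ¬e∣1+k+x) (sum-ifDivides-gap (suc k) n e∣x (subst (_< e) (+-suc k n) k+n<e))
  where
  ¬e∣1+k+x : ¬ e ∣ suc k + x
  ¬e∣1+k+x e∣1+k+x = <⇒≱ (≤-<-trans (m≤m+n (suc k) n) (subst (_< e) (+-suc k n) k+n<e))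
                          (∣⇒≤ (∣m+n∣m⇒∣n (subst (e ∣_) (+-comm (suc k) x) e∣1+k+x) e∣x))

-- n ≤ e consecutive numbers contain at most one multiple of e
sum-ifDivides-short : ∀ {e} x n → n ≤ e → sum (map (ifDivides e) (iterate suc x n)) ≤ e
sum-ifDivides-short x zero n≤e = z≤n
sum-ifDivides-short {e} x (suc n) n<e = case e ∣? x of λ where
  (yes e∣x) → ≤-reflexive (trans (cong₂ _+_ (ifDivides-yes e∣x) (sum-ifDivides-gap {e} {x} 0 n e∣x n<e)) (+-identityʳ e))
  (no ¬e∣x) → ≤-trans (≤-reflexive (cong (_+ sum (map (ifDivides e) (iterate suc (suc x) n))) (ifDivides-no ¬e∣x)))
                      (sum-ifDivides-short (suc x) n (<⇒≤ n<e))

sum-ifDivides-periods : ∀ e x m → sum (map (ifDivides e) (iterate suc x (m * e))) ≤ m * e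
sum-ifDivides-periods e x zero = z≤n
sum-ifDivides-periods e x (suc m) = begin
  sum (map (ifDivides e) (iterate suc x (e + m * e)))
    ≡⟨ cong (sum ∘ map (ifDivides e)) (iterate-suc-++ x e (m * e)) ⟩
  sum (map (ifDivides e) (iterate suc x e ++ iterate suc (e + x) (m * e)))
    ≡⟨ cong sum (map-++ (ifDivides e) (iterate suc x e) _) ⟩
  sum (map (ifDivides e) (iterate suc x e) ++ map (ifDivides e) (iterate suc (e + x) (m * e)))
    ≡⟨ sum-++ (map (ifDivides e) (iterate suc x e)) _ ⟩
  sum (map (ifDivides e) (iterate suc x e)) + sum (map (ifDivides e) (iterate suc (e + x) (m * e)))
    ≤⟨ +-mono-≤ (sum-ifDivides-short x e ≤-refl) (sum-ifDivides-periods e (e + x) m) ⟩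
  e + m * e ∎
  where open ≤-Reasoning

sum-ifDivides-≤ : ∀ {e N} x → e ∣ N → sum (map (ifDivides e) (iterate suc x N)) ≤ N
sum-ifDivides-≤ {e} x (divides-refl m) = sum-ifDivides-periods e x m

divisors : ℕ → List ℕ
divisors N = filter (_∣? N) (map suc (upTo N))

common-divisor≤sum-ifDivides : ∀ {g x N} .{{_ : NonZero N}} → g ∣ x → g ∣ N →
  g ≤ sum (map (λ e → ifDivides e x) (divisors N))
common-divisor≤sum-ifDivides {zero} {N = N} _ 0∣N = ⊥-elim (≢-nonZero⁻¹ N (0∣⇒≡0 0∣N))
common-divisor≤sum-ifDivides {suc k} {x} {N} g∣x g∣N = begin
  suc k                                           ≡⟨ ifDivides-yes g∣x ⟨
  ifDivides (suc k) x                             ≤⟨ ∈⇒≤sum-map (λ e → ifDivides e x) g∈divisors ⟩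
  sum (map (λ e → ifDivides e x) (divisors N))    ∎
  where
  open ≤-Reasoning
  g∈divisors : suc k ∈ divisors N
  g∈divisors = ∈-filter⁺ (_∣? N) (∈-map⁺ suc (∈-upTo⁺ (∣⇒≤ g∣N))) g∣N

sum-gcd≤N*τ : ∀ N .{{_ : NonZero N}} x → sum (map (λ y → gcd y N) (iterate suc x N)) ≤ N * τ N
sum-gcd≤N*τ N x = begin
  sum (map (λ y → gcd y N) ys)
    ≤⟨ sum-map-mono-≤ (λ y → common-divisor≤sum-ifDivides (gcd[m,n]∣m y N) (gcd[m,n]∣n y N)) ys ⟩
  sum (map (λ y → sum (map (λ e → ifDivides e y) (divisors N))) ys)
    ≡⟨ sum-map-comm (λ y e → ifDivides e y) ys (divisors N) ⟩
  sum (map (λ e → sum (map (ifDivides e) ys)) (divisors N))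
    ≤⟨ sum-map-≤-const _ N (divisors N) (λ e∈divisors → sum-ifDivides-≤ x (proj₂ (∈-filter⁻ (_∣? N) {xs = map suc (upTo N)} e∈divisors))) ⟩
  τ N * N
    ≡⟨ *-comm (τ N) N ⟩
  N * τ N ∎
  where
  open ≤-Reasoning
  ys = iterate suc x N

-- Linear congruences in a window

module _ {d} .{{_ : NonZero d}} (P : ℕ → Set) (P-up : ∀ s → P s → P (d + s)) (P-down : ∀ s → P (d + s) → P s) where

  private
    P-down* : ∀ k s → P (k * d + s) → P s
    P-down* zero s Ps = Ps
    P-down* (suc k) s P[1+k]d+s = P-down* k s (P-down (k * d + s) (subst P (+-assoc d (k * d) s) P[1+k]d+s))

    P-mod : ∀ {s} → P s → P (s % d)
    P-mod {s} Ps = P-down* (s / d) (s % d) (subst P (trans (m≡m%n+[m/n]*n s d) (+-comm (s % d) _)) Ps)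

  periodic-window : ∀ {s₀} → P s₀ → ∀ g → ∃[ s ] g < s × s ≤ g + d × P s
  periodic-window {s₀} Ps₀ zero with s₀ % d | m%n<n s₀ d | P-mod Ps₀
  ... | zero  | _   | P0 = d , >-nonZero⁻¹ d , ≤-refl , subst P (+-identityʳ d) (P-up 0 P0)
  ... | suc t | t<d | Pt = suc t , z<s , <⇒≤ t<d , Pt
  periodic-window Ps₀ (suc g) with periodic-window Ps₀ g
  ... | s , g<s , s≤g+d , Ps with suc g <? s
  ...   | yes g+1<s = s , g+1<s , m≤n⇒m≤1+n s≤g+d , Ps
  ...   | no  g+1≮s rewrite ≤-antisym (≮⇒≥ g+1≮s) g<s =
          d + suc g , m<n+m (suc g) (>-nonZero⁻¹ d) , ≤-reflexive (+-comm d (suc g)) , P-up (suc g) Ps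

coprime⇒∃[x]d∣a*x+1 : ∀ {a d} .{{_ : NonZero d}} → Coprime a d → ∃[ x ] d ∣ a * x + 1
coprime⇒∃[x]d∣a*x+1 {a} {d} cop with coprime-Bézout cop
... | Bézout.-+ x y 1+xa≡yd = x , divides y (trans (+-comm (a * x) 1) (trans (cong suc (*-comm a x)) 1+xa≡yd))
coprime⇒∃[x]d∣a*x+1 {a} {suc d} cop | Bézout.+- x y 1+yd≡xa =
  x * d , ∣m+n∣m⇒∣n (subst (suc d ∣_) (sym eq) (n∣m*n (x * a))) (n∣m*n y)
  where
  open ≡-Reasoning
  -- a x ≡ 1, so a (x d) ≡ a x (d + 1) - 1 ≡ -1  (mod d + 1)
  eq : y * suc d + (a * (x * d) + 1) ≡ x * a * suc d
  eq = begin
    y * suc d + (a * (x * d) + 1) ≡⟨ lhs a x y d ⟩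
    a * (x * d) + (1 + y * suc d) ≡⟨ cong (a * (x * d) +_) 1+yd≡xa ⟩
    a * (x * d) + x * a           ≡⟨ rhs a x d ⟩
    x * a * suc d                 ∎
    where
    lhs : ∀ a x y d → y * suc d + (a * (x * d) + 1) ≡ a * (x * d) + (1 + y * suc d)
    lhs = solve-∀
    rhs : ∀ a x d → a * (x * d) + x * a ≡ x * a * suc d
    rhs = solve-∀

coprime⇒∃[s]d∣a*s+c : ∀ {a d} .{{_ : NonZero d}} → Coprime a d → ∀ c → ∃[ s ] d ∣ a * s + c
coprime⇒∃[s]d∣a*s+c {a} {d} cop c with coprime⇒∃[x]d∣a*x+1 cop
... | x , d∣ax+1 = x * c , subst (d ∣_) (scale a x c) (∣m⇒∣m*n c d∣ax+1)
  where
  scale : ∀ a x c → (a * x + 1) * c ≡ a * (x * c) + c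
  scale = solve-∀

coprime-window : ∀ {a d} .{{_ : NonZero d}} → Coprime a d → ∀ c g → ∃[ s ] g < s × s ≤ g + d × d ∣ a * s + c
coprime-window {a} {d} cop c = periodic-window (λ s → d ∣ a * s + c) up down (proj₂ (coprime⇒∃[s]d∣a*s+c cop c))
  where
  shift : ∀ s → a * (d + s) + c ≡ a * d + (a * s + c)
  shift s = trans (cong (_+ c) (*-distribˡ-+ a d s)) (+-assoc (a * d) (a * s) c)
  up : ∀ s → d ∣ a * s + c → d ∣ a * (d + s) + c
  up s d∣as+c = subst (d ∣_) (sym (shift s)) (∣m∣n⇒∣m+n (n∣m*n a) d∣as+c)
  down : ∀ s → d ∣ a * (d + s) + c → d ∣ a * s + c
  down s d∣a[d+s]+c = ∣m+n∣m⇒∣n (subst (d ∣_) (shift s) d∣a[d+s]+c) (n∣m*n a)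

-- Farey neighbours

gcd-nonZeroʳ : ∀ m n .{{_ : NonZero n}} → NonZero (gcd m n)
gcd-nonZeroʳ m n = ≢-nonZero (gcd[m,n]≢0 m n (inj₂ (≢-nonZero⁻¹ n)))

record LowestTerms (m n : ℕ) : Set where
  field
    num den   : ℕ
    m≡num*gcd : m ≡ num * gcd m n
    n≡den*gcd : n ≡ den * gcd m n
    coprime   : Coprime num den

  module _ .{{_ : NonZero n}} where

    private instance
      gcd≢0 : NonZero (gcd m n)
      gcd≢0 = gcd-nonZeroʳ m n

    num-nonZero : .{{_ : NonZero m}} → NonZero num
    num-nonZero = m*n≢0⇒m≢0 num {{subst NonZero m≡num*gcd it}}

    den-nonZero : NonZero den
    den-nonZero = m*n≢0⇒m≢0 den {{subst NonZero n≡den*gcd it}}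

    den∣ : ∀ {p q} → p * n ≡ m * q → den ∣ q
    den∣ {p} {q} pn≡mq = coprime-divisor (Coprime.sym coprime) (divides p (sym (*-cancelʳ-≡ (p * den) (num * q) (gcd m n) eq)))
      where
      open ≡-Reasoning
      eq : p * den * gcd m n ≡ num * q * gcd m n
      eq = begin
        p * den * gcd m n       ≡⟨ *-assoc p den _ ⟩
        p * (den * gcd m n)     ≡⟨ cong (p *_) n≡den*gcd ⟨
        p * n                   ≡⟨ pn≡mq ⟩
        m * q                   ≡⟨ cong (_* q) m≡num*gcd ⟩
        num * gcd m n * q       ≡⟨ *-assoc num _ q ⟩
        num * (gcd m n * q)     ≡⟨ cong (num *_) (*-comm (gcd m n) q) ⟩
        num * (q * gcd m n)     ≡⟨ *-assoc num q _ ⟨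
        num * q * gcd m n       ∎

lowestTerms : ∀ m n .{{_ : NonZero n}} → LowestTerms m n
lowestTerms m n = record
  { num       = m / gcd m n
  ; den       = n / gcd m n
  ; m≡num*gcd = sym (m/n*n≡m (gcd[m,n]∣m m n))
  ; n≡den*gcd = sym (m/n*n≡m (gcd[m,n]∣n m n))
  ; coprime   = coprime-/gcd m n
  }
  where instance
    gcd≢0 : NonZero (gcd m n)
    gcd≢0 = gcd-nonZeroʳ m n

d∣m+pred[d]⇒m≡r*d+1 : ∀ {m d} .{{_ : NonZero m}} .{{_ : NonZero d}} → d ∣ m + pred d → ∃[ r ] m ≡ r * d + 1
d∣m+pred[d]⇒m≡r*d+1 {suc m} {suc d} (divides (suc r) eq) = r , +-cancelʳ-≡ d (suc m) (r * suc d + 1) (trans eq (shuffle r d))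
  where
  shuffle : ∀ r d → suc r * suc d ≡ r * suc d + 1 + d
  shuffle = solve-∀

farey-neighbour-above : ∀ j {n q} .{{_ : NonZero n}} .{{_ : NonZero q}} p → p * n ≡ j * q →
  ∃[ r ] ∃[ s ] j * suc s < r * n × r * n ≤ suc j * suc s × suc s ≤ q + gcd j n
farey-neighbour-above j {n} {q} p pn≡jq = neighbour (coprime-window {{den-nonZero}} coprime 1 g)
  where
  open LowestTerms (lowestTerms j n)
  g = gcd j n
  instance
    g≢0 : NonZero g
    g≢0 = gcd-nonZeroʳ j n

  neighbour : ∃[ s ] g < s × s ≤ g + den × den ∣ num * s + 1 →
              ∃[ r ] ∃[ s ] j * suc s < r * n × r * n ≤ suc j * suc s × suc s ≤ q + g
  neighbour (suc s , g<s , s≤g+den , divides r as+1≡rd) = r , s , js<rn , rn≤[1+j]s , ≤-trans s≤g+den g+den≤q+g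
    where
    open ≤-Reasoning
    distrib : ∀ a s g → (a * s + 1) * g ≡ a * g * s + g
    distrib = solve-∀
    rn≡js+g : r * n ≡ j * suc s + g
    rn≡js+g = begin-equality
      r * n                     ≡⟨ cong (r *_) n≡den*gcd ⟩
      r * (den * g)             ≡⟨ *-assoc r den g ⟨
      r * den * g               ≡⟨ cong (_* g) as+1≡rd ⟨
      (num * suc s + 1) * g     ≡⟨ distrib num (suc s) g ⟩
      num * g * suc s + g       ≡⟨ cong (λ t → t * suc s + g) m≡num*gcd ⟨
      j * suc s + g             ∎
    js<rn : j * suc s < r * n
    js<rn = subst (j * suc s <_) (sym rn≡js+g) (m<m+n (j * suc s) (>-nonZero⁻¹ g))
    rn≤[1+j]s : r * n ≤ suc j * suc s
    rn≤[1+j]s = begin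
      r * n                     ≡⟨ rn≡js+g ⟩
      j * suc s + g             ≤⟨ +-monoʳ-≤ (j * suc s) (<⇒≤ g<s) ⟩
      j * suc s + suc s         ≡⟨ +-comm (j * suc s) (suc s) ⟩
      suc j * suc s             ∎
    g+den≤q+g : g + den ≤ q + g
    g+den≤q+g = subst (g + den ≤_) (+-comm g q) (+-monoʳ-≤ g (∣⇒≤ (den∣ {p} pn≡jq)))

farey-neighbour-below : ∀ j {n q} .{{_ : NonZero n}} .{{_ : NonZero q}} p → p * n ≡ suc j * q →
  ∃[ r ] ∃[ s ] j * suc s < r * n × r * n < suc j * suc s × suc s ≤ q + gcd (suc j) n
-- The window congruence den ∣ num s + (den - 1) says num s ≡ 1 (mod den).
farey-neighbour-below j {n} {q} p pn≡[1+j]q = neighbour (coprime-window {{den-nonZero}} coprime (pred den) g)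
  where
  open LowestTerms (lowestTerms (suc j) n)
  g = gcd (suc j) n
  instance
    g≢0 : NonZero g
    g≢0 = gcd-nonZeroʳ (suc j) n
    num≢0 : NonZero num
    num≢0 = num-nonZero
    den≢0 : NonZero den
    den≢0 = den-nonZero

  neighbour : ∃[ s ] g < s × s ≤ g + den × den ∣ num * s + pred den →
              ∃[ r ] ∃[ s ] j * suc s < r * n × r * n < suc j * suc s × suc s ≤ q + g
  neighbour (suc s , g<s , s≤g+den , den∣as+den-1) with d∣m+pred[d]⇒m≡r*d+1 {num * suc s} {{m*n≢0 num (suc s)}} den∣as+den-1
  ... | r , as≡rd+1 = r , s , js<rn , rn<[1+j]s , ≤-trans s≤g+den g+den≤q+g
    where
    open ≤-Reasoning
    shuffle : ∀ a g s → a * g * s ≡ a * s * g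
    shuffle = solve-∀
    distrib : ∀ r d g → (r * d + 1) * g ≡ r * (d * g) + g
    distrib = solve-∀
    [1+j]s≡rn+g : suc j * suc s ≡ r * n + g
    [1+j]s≡rn+g = begin-equality
      suc j * suc s             ≡⟨ cong (_* suc s) m≡num*gcd ⟩
      num * g * suc s           ≡⟨ shuffle num g (suc s) ⟩
      num * suc s * g           ≡⟨ cong (_* g) as≡rd+1 ⟩
      (r * den + 1) * g         ≡⟨ distrib r den g ⟩
      r * (den * g) + g         ≡⟨ cong (λ t → r * t + g) n≡den*gcd ⟨
      r * n + g                 ∎
    rn<[1+j]s : r * n < suc j * suc s
    rn<[1+j]s = subst (r * n <_) (sym [1+j]s≡rn+g) (m<m+n (r * n) (>-nonZero⁻¹ g))
    js<rn : j * suc s < r * n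
    js<rn = +-cancelʳ-< g (j * suc s) (r * n) (begin-strict
      j * suc s + g             <⟨ +-monoʳ-< (j * suc s) g<s ⟩
      j * suc s + suc s         ≡⟨ +-comm (j * suc s) (suc s) ⟩
      suc j * suc s             ≡⟨ [1+j]s≡rn+g ⟩
      r * n + g                 ∎)
    g+den≤q+g : g + den ≤ q + g
    g+den≤q+g = subst (g + den ≤_) (+-comm g q) (+-monoʳ-≤ g (∣⇒≤ (den∣ {p} pn≡[1+j]q)))

toℚᵘ-÷ : ∀ i m → toℚᵘ (i ÷ suc m) ≃ᵘ mkℚᵘ i m
toℚᵘ-÷ i m = /-injective-≃ (toℚᵘ (i ÷ suc m)) (mkℚᵘ i m) (↥ᵘp/↧ᵘp≡p (i ÷ suc m))
  where
  -- matching on mkℚ lets toℚᵘ p compute to its numerator and denominator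
  ↥ᵘp/↧ᵘp≡p : ∀ p → ℚᵘ.↥ (toℚᵘ p) ÷ ℚᵘ.↧ₙ (toℚᵘ p) ≡ p
  ↥ᵘp/↧ᵘp≡p p@(mkℚ _ _ _) = ↥p/↧p≡p p

module _ (i : ℤ.ℤ) (m : ℕ) (i' : ℤ.ℤ) (m' : ℕ) where

  ÷<⇒*< : i ÷ suc m <ℚ i' ÷ suc m' → i ℤ.* ℤ.+ suc m' ℤ.< i' ℤ.* ℤ.+ suc m
  ÷<⇒*< p<q with ℚᵘ.<-respˡ-≃ (toℚᵘ-÷ i m) (ℚᵘ.<-respʳ-≃ (toℚᵘ-÷ i' m') (toℚᵘ-mono-< p<q))
  ... | *<* lt = lt

  *<⇒÷< : i ℤ.* ℤ.+ suc m' ℤ.< i' ℤ.* ℤ.+ suc m → i ÷ suc m <ℚ i' ÷ suc m'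
  *<⇒÷< lt = toℚᵘ-cancel-< (ℚᵘ.<-respˡ-≃ (ℚᵘ.≃-sym (toℚᵘ-÷ i m)) (ℚᵘ.<-respʳ-≃ (ℚᵘ.≃-sym (toℚᵘ-÷ i' m')) (*<* lt)))

  ÷≤⇒*≤ : i ÷ suc m ≤ℚ i' ÷ suc m' → i ℤ.* ℤ.+ suc m' ℤ.≤ i' ℤ.* ℤ.+ suc m
  ÷≤⇒*≤ p≤q with ℚᵘ.≤-respˡ-≃ (toℚᵘ-÷ i m) (ℚᵘ.≤-respʳ-≃ (toℚᵘ-÷ i' m') (toℚᵘ-mono-≤ p≤q))
  ... | *≤* le = le

  *≤⇒÷≤ : i ℤ.* ℤ.+ suc m' ℤ.≤ i' ℤ.* ℤ.+ suc m → i ÷ suc m ≤ℚ i' ÷ suc m'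
  *≤⇒÷≤ le = toℚᵘ-cancel-≤ (ℚᵘ.≤-respˡ-≃ (ℚᵘ.≃-sym (toℚᵘ-÷ i m)) (ℚᵘ.≤-respʳ-≃ (ℚᵘ.≃-sym (toℚᵘ-÷ i' m')) (*≤* le)))

module _ (a m b m' : ℕ) where

  ℕ*<⇒÷< : a * suc m' < b * suc m → ℤ.+ a ÷ suc m <ℚ ℤ.+ b ÷ suc m'
  ℕ*<⇒÷< lt = *<⇒÷< (ℤ.+ a) m (ℤ.+ b) m' (subst₂ ℤ._<_ (ℤ.pos-* a (suc m')) (ℤ.pos-* b (suc m)) (ℤ.+<+ lt))

  ℕ*≤⇒÷≤ : a * suc m' ≤ b * suc m → ℤ.+ a ÷ suc m ≤ℚ ℤ.+ b ÷ suc m'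
  ℕ*≤⇒÷≤ le = *≤⇒÷≤ (ℤ.+ a) m (ℤ.+ b) m' (subst₂ ℤ._≤_ (ℤ.pos-* a (suc m')) (ℤ.pos-* b (suc m)) (ℤ.+≤+ le))

IsQ-minimal : ∀ E {q k} → IsQ E q → ∀ p → E (p ÷ suc k) → q ≤ suc k
IsQ-minimal E {k = k} (k₀ , refl , _ , minimal) p p∈E = s≤s (≮⇒≥ (λ k<k₀ → minimal k k<k₀ (p , p∈E)))

module _ {n} (i : Fin (suc n)) where

  private
    N = suc n
    j = toℕ i
    closed half-open open′ : ℚ → Set
    closed    = Icc (lo N i) (hi N i)
    half-open = Ioc (lo N i) (hi N i)
    open′     = Ioo (lo N i) (hi N i)

  Ioo≤Ioc+gcd : ∀ {f h} → IsQ half-open f → IsQ open′ h → h ≤ f + gcd (suc j) N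
  Ioo≤Ioc+gcd {h = h} (k , refl , (p , lo<x , x≤hi) , _) isQ-h =
    case ℤ.<-cmp (p ℤ.* ℤ.+ N) (ℤ.+ suc j ℤ.* ℤ.+ suc k) of λ where
      (tri< x<hi _ _) → ≤-trans (IsQ-minimal open′ isQ-h p (lo<x , *<⇒÷< p k (ℤ.+ suc j) n x<hi)) (m≤m+n (suc k) _)
      (tri> _ _ x>hi) → ⊥-elim (ℤ.≤⇒≯ (÷≤⇒*≤ p k (ℤ.+ suc j) n x≤hi) x>hi)
      (tri≈ _ x≡hi _) → at-endpoint p x≡hi
    where
    at-endpoint : ∀ p → p ℤ.* ℤ.+ N ≡ ℤ.+ suc j ℤ.* ℤ.+ suc k → h ≤ suc k + gcd (suc j) N
    at-endpoint (ℤ.+ p') eq =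
      let r , s , js<rn , rn<[1+j]s , s≤q+g = farey-neighbour-below j p' (ℤ.+-injective (trans (ℤ.pos-* p' N) eq))
      in ≤-trans (IsQ-minimal open′ isQ-h (ℤ.+ r) (ℕ*<⇒÷< j n r s js<rn , ℕ*<⇒÷< r s (suc j) n rn<[1+j]s)) s≤q+g

  Ioc≤Icc+gcd : ∀ {g f} → IsQ closed g → IsQ half-open f → f ≤ g + gcd j N
  Ioc≤Icc+gcd {f = f} (k , refl , (p , lo≤x , x≤hi) , _) isQ-f =
    case ℤ.<-cmp (ℤ.+ j ℤ.* ℤ.+ suc k) (p ℤ.* ℤ.+ N) of λ where
      (tri< lo<x _ _) → ≤-trans (IsQ-minimal half-open isQ-f p (*<⇒÷< (ℤ.+ j) n p k lo<x , x≤hi)) (m≤m+n (suc k) _)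
      (tri> _ _ lo>x) → ⊥-elim (ℤ.≤⇒≯ (÷≤⇒*≤ (ℤ.+ j) n p k lo≤x) lo>x)
      (tri≈ _ lo≡x _) → at-endpoint p (trans (sym lo≡x) (sym (ℤ.pos-* j (suc k))))
    where
    at-endpoint : ∀ p → p ℤ.* ℤ.+ N ≡ ℤ.+ (j * suc k) → f ≤ suc k + gcd j N
    at-endpoint (ℤ.+ p') eq =
      let r , s , js<rn , rn≤[1+j]s , s≤q+g = farey-neighbour-above j p' (ℤ.+-injective (trans (ℤ.pos-* p' N) eq))
      in ≤-trans (IsQ-minimal half-open isQ-f (ℤ.+ r) (ℕ*<⇒÷< j n r s js<rn , ℕ*≤⇒÷≤ r s (suc j) n rn≤[1+j]s)) s≤q+g

sumFin-≤-+gcd : ∀ N .{{_ : NonZero N}} {u v : Fin N → ℕ} c →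
  (∀ i → u i ≤ v i + gcd (c + toℕ i) N) → sumFin N u ≤ sumFin N v + N * τ N
sumFin-≤-+gcd N {u} {v} c u≤v+gcd = begin
  sumFin N u
    ≤⟨ sum-map-mono-≤ u≤v+gcd (allFin N) ⟩
  sum (map (λ i → v i + gcd (c + toℕ i) N) (allFin N))
    ≡⟨ sum-map-+ v (λ i → gcd (c + toℕ i) N) (allFin N) ⟩
  sumFin N v + sum (map (λ i → gcd (c + toℕ i) N) (allFin N))
    ≡⟨ cong (λ ys → sumFin N v + sum ys) (map-shifted-allFin (λ y → gcd y N) c N) ⟩
  sumFin N v + sum (map (λ y → gcd y N) (iterate suc (c + 0) N))
    ≤⟨ +-monoʳ-≤ (sumFin N v) (sum-gcd≤N*τ N (c + 0)) ⟩
  sumFin N v + N * τ N ∎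
  where open ≤-Reasoning

proposition7 : (N : ℕ) → .{{_ : NonZero N}} → (f g h : Fin N → ℕ)
    → (∀ i → IsQ (Ioc (lo N i) (hi N i)) (f i))
    → (∀ i → IsQ (Icc (lo N i) (hi N i)) (g i))
    → (∀ i → IsQ (Ioo (lo N i) (hi N i)) (h i))
    → (sumFin N h ≤ sumFin N f + N * τ N) × (sumFin N f ≤ sumFin N g + N * τ N)
proposition7 (suc n) f g h isQ-f isQ-g isQ-h =
    sumFin-≤-+gcd (suc n) 1 (λ i → Ioo≤Ioc+gcd i (isQ-f i) (isQ-h i))
  , sumFin-≤-+gcd (suc n) 0 (λ i → Ioc≤Icc+gcd i (isQ-g i) (isQ-f i))
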